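{- Let \[ M=\begin{bmatrix} C & B\\ B^T & D\end{bmatrix} \] be a real matrix where $C$ is an $m\times m$ symmetric matrix, $B=[b_1\ \cdots\ b_n]$ is an $m\times n$ matrix with no zero columns, and $D=\operatorname{diag}(d_1,\dots,d_n)$. If $M$ is orthogonal, then $n\le m$, the vectors $b_1,\dots,b_n$ are pairwise orthogonal, and each $b_i$ is an eigenvector of $C$ for the eigenvalue $-d_i$. -}

module Defs where

open import Level using (Level; _⊔_) renaming (suc to lsuc)
open import Algebra.Bundles using (CommutativeRing)
open import Relation.Binary.Core using (Rel)
open import Relation.Binary.Structures using (IsTotalOrder)
open import Relation.Nullary using (¬_; yes; no)
open import Relation.Binary.PropositionalEquality using (_≡_)
open import Data.Product using (∃; _×_)
open import Data.Sum using ([_,_])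
open import Data.Nat using (ℕ; zero; suc) renaming (_+_ to _+ℕ_)
open import Data.Fin using (Fin; splitAt) renaming (zero to fzero; suc to fsuc)
import Data.Fin as Fin

-- The real numbers are not available in agda-stdlib.  We axiomatise them
-- as a complete ordered field (unique up to isomorphism: this is ℝ).
record CompleteOrderedField (c ℓ₁ ℓ₂ : Level) : Set (lsuc (c ⊔ ℓ₁ ⊔ ℓ₂)) where
  field
    commutativeRing : CommutativeRing c ℓ₁
  open CommutativeRing commutativeRing public
  field
    _≤_          : Rel Carrier ℓ₂
    isTotalOrder : IsTotalOrder _≈_ _≤_
    0≉1          : ¬ (0# ≈ 1#)
    inverse      : ∀ x → ¬ (x ≈ 0#) → ∃ λ y → x * y ≈ 1#
    +-mono-≤     : ∀ {x y} z → x ≤ y → (x + z) ≤ (y + z)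
    *-nonneg     : ∀ {x y} → 0# ≤ x → 0# ≤ y → 0# ≤ (x * y)
    sup          : (P : Carrier → Set (c ⊔ ℓ₁ ⊔ ℓ₂)) → ∃ P →
                   (∃ λ u → ∀ x → P x → x ≤ u) →
                   ∃ λ s → (∀ x → P x → x ≤ s) ×
                           (∀ u → (∀ x → P x → x ≤ u) → s ≤ u)

module Matrices {c ℓ₁ ℓ₂} (F : CompleteOrderedField c ℓ₁ ℓ₂) where
  open CompleteOrderedField F

  Mat : ℕ → ℕ → Set c
  Mat m n = Fin m → Fin n → Carrier

  Σ : ∀ {k} → (Fin k → Carrier) → Carrier
  Σ {zero}  f = 0#
  Σ {suc k} f = f fzero + Σ (λ i → f (fsuc i))

  _ᵀ : ∀ {m n} → Mat m n → Mat n m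
  (A ᵀ) i j = A j i

  _⊗_ : ∀ {m k n} → Mat m k → Mat k n → Mat m n
  (A ⊗ B) i j = Σ (λ l → A i l * B l j)

  I : ∀ {n} → Mat n n
  I i j with i Fin.≟ j
  ... | yes _ = 1#
  ... | no  _ = 0#

  diag : ∀ {n} → (Fin n → Carrier) → Mat n n
  diag d i j with i Fin.≟ j
  ... | yes _ = d i
  ... | no  _ = 0#

  _≈ₘ_ : ∀ {m n} → Mat m n → Mat m n → Set ℓ₁
  A ≈ₘ B = ∀ i j → A i j ≈ B i j

  Symmetric : ∀ {n} → Mat n n → Set ℓ₁
  Symmetric A = ∀ i j → A i j ≈ A j i

  Orthogonal : ∀ {n} → Mat n n → Set ℓ₁
  Orthogonal A = ((A ⊗ (A ᵀ)) ≈ₘ I) × (((A ᵀ) ⊗ A) ≈ₘ I)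

  block : ∀ {m n} → Mat m m → Mat m n → Mat n n → Mat (m +ℕ n) (m +ℕ n)
  block {m} C B D i j =
    [ (λ i' → [ (λ j' → C i' j') , (λ j' → B i' j') ] (splitAt m j))
    , (λ i' → [ (λ j' → B j' i') , (λ j' → D i' j') ] (splitAt m j))
    ] (splitAt m i)

  col : ∀ {m n} → Mat m n → Fin n → Fin m → Carrier
  col B j i = B i j

  _·_ : ∀ {m} → (Fin m → Carrier) → (Fin m → Carrier) → Carrier
  u · v = Σ (λ i → u i * v i)

  ZeroVec : ∀ {m} → (Fin m → Carrier) → Set ℓ₁
  ZeroVec v = ∀ i → v i ≈ 0#

  Eigenvector : ∀ {m} → Mat m m → Carrier → (Fin m → Carrier) → Set ℓ₁
  Eigenvector A λ' v = ¬ ZeroVec v × (∀ i → Σ (λ l → A i l * v l) ≈ λ' * v i)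

-- The rows of the orthogonal matrix M are orthonormal.  The products of its last n rows
-- with each other read b_i · b_j + d_i d_j δ_ij = δ_ij, so distinct b_i are orthogonal; the
-- products of its first m rows with its last n rows read C b_j + d_j b_j = 0.  In an ordered
-- field a nonzero vector has nonzero square norm, so pairwise orthogonal nonzero vectors are
-- linearly independent, and Gaussian elimination shows that m equations in n > m unknowns
-- always have a nonzero solution; hence n ≤ m.  Since equality with 0 is not decidable,
-- the elimination splits cases under a double negation, which is harmless because its goal
-- is a contradiction.
module Submission where

open import Defs
open import Level using (Level; _⊔_)
open import Data.Nat as ℕ using (ℕ; zero; suc; s≤s; z≤n) renaming (_≤_ to _≤ℕ_; _<_ to _<ℕ_)
open import Data.Nat.Properties using (≮⇒≥)
open import Data.Fin as Fin using (Fin; _↑ˡ_; _↑ʳ_; punchIn) renaming (zero to fzero; suc to fsuc)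
open import Data.Fin.Properties
  using (splitAt-↑ˡ; splitAt-↑ʳ; ↑ʳ-injective; punchInᵢ≢i; punchIn-punchOut; ∀-cons)
open import Data.Vec.Functional using (_∷_; tail; removeAt)
open import Data.Product using (_×_; _,_; ∃)
open import Data.Sum using (_⊎_; inj₁; inj₂; [_,_])
open import Data.Empty using (⊥)
open import Function using (_∘_)
open import Relation.Nullary using (¬_; yes; no; contradiction)
open import Relation.Nullary.Decidable using (¬¬-excluded-middle)
open import Relation.Binary.Structures using (IsTotalOrder)
import Relation.Binary.PropositionalEquality as ≡
open ≡ using (_≡_; _≢_)

¬¬-Π : ∀ {k p} {P : Fin k → Set p} → (∀ i → ¬ ¬ P i) → ¬ ¬ (∀ i → P i)
¬¬-Π {zero}  ¬¬P ¬∀P = ¬∀P (λ ())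
¬¬-Π {suc k} ¬¬P ¬∀P = ¬¬P fzero λ P0 → ¬¬-Π (¬¬P ∘ fsuc) (¬∀P ∘ ∀-cons P0)

↑ˡ≢↑ʳ : ∀ m n (i : Fin m) (j : Fin n) → i ↑ˡ n ≢ m ↑ʳ j
↑ˡ≢↑ʳ m n i j eq
  with ≡.trans (≡.sym (splitAt-↑ˡ m i n)) (≡.trans (≡.cong (Fin.splitAt m) eq) (splitAt-↑ʳ m n j))
... | ()

module _ {c ℓ₁ ℓ₂} (F : CompleteOrderedField c ℓ₁ ℓ₂) where
  open CompleteOrderedField F
  open Matrices F
  open import Algebra.Properties.Ring ring using (-‿distribˡ-*; -‿distribʳ-*; -‿involutive; -1*x≈-x; +-inverseˡ-unique)
  open import Algebra.Properties.Semiring.Sum semiring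
    using (sum; sum-cong-≋; sum-cong-≗; sum-replicate-zero; sum-remove; ∑-distrib-+; ∑-comm; *-distribˡ-sum; *-distribʳ-sum)
  open import Relation.Binary.Reasoning.Setoid setoid
  private module ≤ = IsTotalOrder isTotalOrder

  Σ≡sum : ∀ {k} (f : Fin k → Carrier) → Σ f ≡ sum f
  Σ≡sum {zero}  f = ≡.refl
  Σ≡sum {suc k} f = ≡.cong (f fzero +_) (Σ≡sum (f ∘ fsuc))

  Σ-cong : ∀ {k} {f g : Fin k → Carrier} → (∀ i → f i ≈ g i) → Σ f ≈ Σ g
  Σ-cong {f = f} {g} f≈g rewrite Σ≡sum f | Σ≡sum g = sum-cong-≋ f≈g

  Σ-zero : ∀ {k} {f : Fin k → Carrier} → (∀ i → f i ≈ 0#) → Σ f ≈ 0#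
  Σ-zero {k} {f} f≈0 rewrite Σ≡sum f = trans (sum-cong-≋ f≈0) (sum-replicate-zero k)

  Σ-distrib-+ : ∀ {k} (f g : Fin k → Carrier) → Σ (λ i → f i + g i) ≈ Σ f + Σ g
  Σ-distrib-+ f g rewrite Σ≡sum f | Σ≡sum g | Σ≡sum (λ i → f i + g i) = ∑-distrib-+ f g

  *-distribˡ-Σ : ∀ {k} x (f : Fin k → Carrier) → x * Σ f ≈ Σ (λ i → x * f i)
  *-distribˡ-Σ x f rewrite Σ≡sum f | Σ≡sum (λ i → x * f i) = *-distribˡ-sum x f

  *-distribʳ-Σ : ∀ {k} x (f : Fin k → Carrier) → Σ f * x ≈ Σ (λ i → f i * x)
  *-distribʳ-Σ x f rewrite Σ≡sum f | Σ≡sum (λ i → f i * x) = *-distribʳ-sum x f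

  Σ-comm : ∀ {k l} (f : Fin k → Fin l → Carrier) →
           Σ (λ i → Σ (f i)) ≈ Σ (λ j → Σ (λ i → f i j))
  Σ-comm f
    rewrite Σ≡sum (λ i → Σ (f i)) | sum-cong-≗ (λ i → Σ≡sum (f i))
          | Σ≡sum (λ j → Σ (λ i → f i j)) | sum-cong-≗ (λ j → Σ≡sum (λ i → f i j))
    = ∑-comm f

  Σ-single : ∀ {k} (f : Fin k → Carrier) j → (∀ i → i ≢ j → f i ≈ 0#) → Σ f ≈ f j
  Σ-single {suc k} f j off rewrite Σ≡sum f = begin
    sum f                     ≈⟨ sum-remove f ⟩
    f j + sum (removeAt f j)  ≡⟨ ≡.cong (f j +_) (Σ≡sum (removeAt f j)) ⟨
    f j + Σ (removeAt f j)    ≈⟨ +-congˡ (Σ-zero (λ i → off _ (punchInᵢ≢i j i))) ⟩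
    f j + 0#                  ≈⟨ +-identityʳ (f j) ⟩
    f j                       ∎

  Σ-splitAt : ∀ m {n} (f : Fin (m ℕ.+ n) → Carrier) →
              Σ f ≈ Σ (λ i → f (i ↑ˡ n)) + Σ (λ j → f (m ↑ʳ j))
  Σ-splitAt zero    f = sym (+-identityˡ _)
  Σ-splitAt (suc m) f = trans (+-congˡ (Σ-splitAt m (f ∘ fsuc))) (sym (+-assoc _ _ _))

  ≤-resp₂-≈ : ∀ {x x' y y'} → x ≈ x' → y ≈ y' → x ≤ y → x' ≤ y'
  ≤-resp₂-≈ x≈x' y≈y' x≤y = ≤.≲-respˡ-≈ x≈x' (≤.≲-respʳ-≈ y≈y' x≤y)

  -x*-x≈x*x : ∀ x → - x * - x ≈ x * x
  -x*-x≈x*x x = begin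
    - x * - x      ≈⟨ -‿distribˡ-* x (- x) ⟨
    - (x * - x)    ≈⟨ -‿cong (-‿distribʳ-* x x) ⟨
    - (- (x * x))  ≈⟨ -‿involutive (x * x) ⟩
    x * x          ∎

  x≤0⇒0≤-x : ∀ {x} → x ≤ 0# → 0# ≤ (- x)
  x≤0⇒0≤-x {x} x≤0 = ≤-resp₂-≈ (-‿inverseʳ x) (+-identityˡ (- x)) (+-mono-≤ (- x) x≤0)

  x*x-nonneg : ∀ x → 0# ≤ (x * x)
  x*x-nonneg x with ≤.total 0# x
  ... | inj₁ 0≤x = *-nonneg 0≤x 0≤x
  ... | inj₂ x≤0 = ≤.≲-respʳ-≈ (-x*-x≈x*x x) (*-nonneg (x≤0⇒0≤-x x≤0) (x≤0⇒0≤-x x≤0))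

  x+y≈0⇒x≈0 : ∀ {x y} → 0# ≤ x → 0# ≤ y → x + y ≈ 0# → x ≈ 0#
  x+y≈0⇒x≈0 {x} {y} 0≤x 0≤y x+y≈0 =
    ≤.antisym (≤-resp₂-≈ (+-identityˡ x) (trans (+-comm y x) x+y≈0) (+-mono-≤ x 0≤y)) 0≤x

  Σ-nonneg : ∀ {k} {f : Fin k → Carrier} → (∀ i → 0# ≤ f i) → 0# ≤ Σ f
  Σ-nonneg {zero}  0≤f = ≤.refl
  Σ-nonneg {suc k} 0≤f =
    ≤.trans (0≤f fzero) (≤-resp₂-≈ (+-identityˡ _) (+-comm _ _) (+-mono-≤ _ (Σ-nonneg (0≤f ∘ fsuc))))

  ·-self≈0⇒x*x≈0 : ∀ {k} (v : Fin k → Carrier) → v · v ≈ 0# → ∀ i → v i * v i ≈ 0#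
  ·-self≈0⇒x*x≈0 v v·v≈0 fzero =
    x+y≈0⇒x≈0 (x*x-nonneg (v fzero)) (Σ-nonneg (λ i → x*x-nonneg (v (fsuc i)))) v·v≈0
  ·-self≈0⇒x*x≈0 v v·v≈0 (fsuc i) =
    ·-self≈0⇒x*x≈0 (v ∘ fsuc)
      (x+y≈0⇒x≈0 (Σ-nonneg (λ i → x*x-nonneg (v (fsuc i)))) (x*x-nonneg (v fzero))
                 (trans (+-comm _ _) v·v≈0)) i

  *-cancelʳ-≉0 : ∀ {x s} → ¬ s ≈ 0# → x * s ≈ 0# → x ≈ 0#
  *-cancelʳ-≉0 {x} {s} s≉0 xs≈0 with inverse s s≉0
  ... | s⁻¹ , ss⁻¹≈1 = begin
    x              ≈⟨ *-identityʳ x ⟨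
    x * 1#         ≈⟨ *-congˡ ss⁻¹≈1 ⟨
    x * (s * s⁻¹)  ≈⟨ *-assoc x s s⁻¹ ⟨
    x * s * s⁻¹    ≈⟨ *-congʳ xs≈0 ⟩
    0# * s⁻¹       ≈⟨ zeroˡ s⁻¹ ⟩
    0#             ∎

  ·-self-≉0 : ∀ {k} {v : Fin k → Carrier} → ¬ ZeroVec v → ¬ v · v ≈ 0#
  ·-self-≉0 {v = v} v≉0 v·v≈0 =
    ¬¬-Π (λ i vi≉0 → vi≉0 (*-cancelʳ-≉0 vi≉0 (·-self≈0⇒x*x≈0 v v·v≈0 i))) v≉0

  ·-linearˡ : ∀ {k} (f g x : Fin k → Carrier) a →
              (λ j → f j + a * g j) · x ≈ f · x + a * (g · x)
  ·-linearˡ f g x a = begin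
    Σ (λ j → (f j + a * g j) * x j)        ≈⟨ Σ-cong (λ j → trans (distribʳ (x j) _ _) (+-congˡ (*-assoc a _ _))) ⟩
    Σ (λ j → f j * x j + a * (g j * x j))  ≈⟨ Σ-distrib-+ (λ j → f j * x j) (λ j → a * (g j * x j)) ⟩
    f · x + Σ (λ j → a * (g j * x j))      ≈⟨ +-congˡ (*-distribˡ-Σ a (λ j → g j * x j)) ⟨
    f · x + a * (g · x)                    ∎

  [uB]x≈u[Bx] : ∀ {m n} (u : Fin m → Carrier) (B : Mat m n) (x : Fin n → Carrier) →
                Σ (λ k → (u · col B k) * x k) ≈ u · (λ i → B i · x)
  [uB]x≈u[Bx] u B x = begin
    Σ (λ k → (u · col B k) * x k)            ≈⟨ Σ-cong (λ k → *-distribʳ-Σ (x k) (λ i → u i * B i k)) ⟩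
    Σ (λ k → Σ (λ i → u i * B i k * x k))    ≈⟨ Σ-cong (λ k → Σ-cong (λ i → *-assoc (u i) (B i k) (x k))) ⟩
    Σ (λ k → Σ (λ i → u i * (B i k * x k)))  ≈⟨ Σ-comm (λ i k → u i * (B i k * x k)) ⟨
    Σ (λ i → Σ (λ k → u i * (B i k * x k)))  ≈⟨ Σ-cong (λ i → *-distribˡ-Σ (u i) (λ k → B i k * x k)) ⟨
    u · (λ i → B i · x)                      ∎

  InKernel : ∀ {r n} → Mat r n → (Fin n → Carrier) → Set ℓ₁
  InKernel A x = ∀ i → A i · x ≈ 0#

  IndependentColumns : ∀ {r n} → Mat r n → Set (c ⊔ ℓ₁)
  IndependentColumns A = ∀ x → InKernel A x → ZeroVec x

  orthogonal⇒independentColumns : ∀ {m n} (B : Mat m n) → (∀ j → ¬ ZeroVec (col B j)) →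
    (∀ i j → i ≢ j → col B i · col B j ≈ 0#) → IndependentColumns B
  orthogonal⇒independentColumns B b≉0 orthogonal x Bx≈0 j =
    *-cancelʳ-≉0 (·-self-≉0 (b≉0 j)) (begin
      x j * (col B j · col B j)            ≈⟨ *-comm _ _ ⟩
      (col B j · col B j) * x j            ≈⟨ Σ-single _ j (λ k k≢j → trans (*-congʳ (orthogonal j k (k≢j ∘ ≡.sym))) (zeroˡ _)) ⟨
      Σ (λ k → (col B j · col B k) * x k)  ≈⟨ [uB]x≈u[Bx] (col B j) B x ⟩
      col B j · (λ i → B i · x)            ≈⟨ Σ-zero (λ i → trans (*-congˡ (Bx≈0 i)) (zeroʳ _)) ⟩
      0#                                   ∎)

  zeroColumn⇒¬independent : ∀ {r n} (A : Mat r (suc n)) → ZeroVec (col A fzero) → ¬ IndependentColumns A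
  zeroColumn⇒¬independent A A₀≈0 independent = 0≉1 (sym (independent e₀ e₀∈ker fzero))
    where
    e₀ : Fin (suc _) → Carrier
    e₀ = 1# ∷ λ _ → 0#
    e₀∈ker : InKernel A e₀
    e₀∈ker i = trans (+-cong (trans (*-identityʳ _) (A₀≈0 i)) (Σ-zero (λ j → zeroʳ (A i (fsuc j))))) (+-identityˡ 0#)

  ¬¬-zero⊎nonzero : ∀ {k} (v : Fin k → Carrier) → ¬ ¬ (ZeroVec v ⊎ ∃ λ i → ¬ v i ≈ 0#)
  ¬¬-zero⊎nonzero v ¬dichotomy = ¬¬-excluded-middle λ where
    (yes nonzero) → ¬dichotomy (inj₂ nonzero)
    (no ¬nonzero) → ¬¬-Π (λ i vi≉0 → ¬nonzero (i , vi≉0)) (¬dichotomy ∘ inj₁)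

  -- Gaussian elimination of the first unknown by the pivot row p (a⁻¹ inverts the pivot A p 0):
  -- back substitution extends solutions of the reduced system to solutions of A.
  module Elimination {r n} (A : Mat (suc r) (suc n)) (p : Fin (suc r))
                     (a⁻¹ : Carrier) (aa⁻¹≈1 : A p fzero * a⁻¹ ≈ 1#) where

    reduced : Mat r n
    reduced k j = A (punchIn p k) (fsuc j) + (A (punchIn p k) fzero * - a⁻¹) * A p (fsuc j)

    backSubstitute : (Fin n → Carrier) → Fin (suc n) → Carrier
    backSubstitute x = - a⁻¹ * (tail (A p) · x) ∷ x

    ·-backSubstitute : ∀ u x → u · backSubstitute x ≈ tail u · x + (u fzero * - a⁻¹) * (tail (A p) · x)
    ·-backSubstitute u x = trans (+-comm _ _) (+-congˡ (sym (*-assoc _ _ _)))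

    pivotRow-solved : ∀ x → A p · backSubstitute x ≈ 0#
    pivotRow-solved x = begin
      A p · backSubstitute x          ≈⟨ ·-backSubstitute (A p) x ⟩
      S + (A p fzero * - a⁻¹) * S     ≈⟨ +-congˡ (*-congʳ (trans (sym (-‿distribʳ-* _ _)) (-‿cong aa⁻¹≈1))) ⟩
      S + - 1# * S                    ≈⟨ +-congˡ (-1*x≈-x S) ⟩
      S + - S                         ≈⟨ -‿inverseʳ S ⟩
      0#                              ∎
      where S = tail (A p) · x

    otherRow-reduced : ∀ x k → A (punchIn p k) · backSubstitute x ≈ reduced k · x
    otherRow-reduced x k = trans (·-backSubstitute (A (punchIn p k)) x) (sym (·-linearˡ _ _ x _))

    backSubstitute-kernel : ∀ x → InKernel reduced x → InKernel A (backSubstitute x)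
    backSubstitute-kernel x reduced-x≈0 i with i Fin.≟ p
    ... | yes ≡.refl = pivotRow-solved x
    ... | no i≢p = ≡.subst (λ i → A i · backSubstitute x ≈ 0#) (punchIn-punchOut (i≢p ∘ ≡.sym))
                     (trans (otherRow-reduced x _) (reduced-x≈0 _))

    independent⇒reduced-independent : IndependentColumns A → IndependentColumns reduced
    independent⇒reduced-independent independent x reduced-x≈0 j =
      independent (backSubstitute x) (backSubstitute-kernel x reduced-x≈0) (fsuc j)

  rows<columns⇒¬independent : ∀ {r n} → r <ℕ n → (A : Mat r n) → ¬ IndependentColumns A
  rows<columns⇒¬independent {zero}  (s≤s z≤n) A = zeroColumn⇒¬independent A (λ ())
  rows<columns⇒¬independent {suc r} (s≤s r<n) A independent =
    ¬¬-zero⊎nonzero (col A fzero) [ (λ A₀≈0 → zeroColumn⇒¬independent A A₀≈0 independent) , eliminate ]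
    where
    eliminate : ∃ (λ p → ¬ A p fzero ≈ 0#) → ⊥
    eliminate (p , a≉0) with inverse (A p fzero) a≉0
    ... | a⁻¹ , aa⁻¹≈1 = rows<columns⇒¬independent r<n reduced (independent⇒reduced-independent independent)
      where open Elimination A p a⁻¹ aa⁻¹≈1

  independentColumns⇒≤ : ∀ {m n} (A : Mat m n) → IndependentColumns A → n ≤ℕ m
  independentColumns⇒≤ A independent = ≮⇒≥ (λ m<n → rows<columns⇒¬independent m<n A independent)

  I-≢ : ∀ {k} {i j : Fin k} → i ≢ j → I i j ≈ 0#
  I-≢ {i = i} {j} i≢j with i Fin.≟ j
  ... | yes i≡j = contradiction i≡j i≢j
  ... | no _    = refl

  diag-≢ : ∀ {k} (d : Fin k → Carrier) {i j} → i ≢ j → diag d i j ≈ 0#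
  diag-≢ d {i} {j} i≢j with i Fin.≟ j
  ... | yes i≡j = contradiction i≡j i≢j
  ... | no _    = refl

  diag-≡ : ∀ {k} (d : Fin k → Carrier) i → diag d i i ≈ d i
  diag-≡ d i with i Fin.≟ i
  ... | yes _   = refl
  ... | no i≢i  = contradiction ≡.refl i≢i

  ·-diag : ∀ {k} (v d : Fin k → Carrier) j → v · diag d j ≈ v j * d j
  ·-diag v d j = trans (Σ-single (λ l → v l * diag d j l) j off-diagonal) (*-congˡ (diag-≡ d j))
    where
    off-diagonal : ∀ l → l ≢ j → v l * diag d j l ≈ 0#
    off-diagonal l l≢j = trans (*-congˡ (diag-≢ d (l≢j ∘ ≡.sym))) (zeroʳ (v l))

  ·-cong-≗ : ∀ {k} {u u' v v' : Fin k → Carrier} →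
             (∀ i → u i ≡ u' i) → (∀ i → v i ≡ v' i) → u · v ≈ u' · v'
  ·-cong-≗ u≗u' v≗v' = Σ-cong (λ i → reflexive (≡.cong₂ _*_ (u≗u' i) (v≗v' i)))

  module _ {m n} (C : Mat m m) (B : Mat m n) (D : Mat n n) where

    block-↑ˡ↑ˡ : ∀ i j → block C B D (i ↑ˡ n) (j ↑ˡ n) ≡ C i j
    block-↑ˡ↑ˡ i j rewrite splitAt-↑ˡ m i n | splitAt-↑ˡ m j n = ≡.refl

    block-↑ˡ↑ʳ : ∀ i j → block C B D (i ↑ˡ n) (m ↑ʳ j) ≡ B i j
    block-↑ˡ↑ʳ i j rewrite splitAt-↑ˡ m i n | splitAt-↑ʳ m n j = ≡.refl

    block-↑ʳ↑ˡ : ∀ i j → block C B D (m ↑ʳ i) (j ↑ˡ n) ≡ B j i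
    block-↑ʳ↑ˡ i j rewrite splitAt-↑ʳ m n i | splitAt-↑ˡ m j n = ≡.refl

    block-↑ʳ↑ʳ : ∀ i j → block C B D (m ↑ʳ i) (m ↑ʳ j) ≡ D i j
    block-↑ʳ↑ʳ i j rewrite splitAt-↑ʳ m n i | splitAt-↑ʳ m n j = ≡.refl

  module OrthonormalRows {m n} (C : Mat m m) (B : Mat m n) (d : Fin n → Carrier)
                         (MMᵀ≈I : (block C B (diag d) ⊗ (block C B (diag d) ᵀ)) ≈ₘ I) where
    private
      M = block C B (diag d)

    rowProduct : ∀ p q → (λ l → M p (l ↑ˡ n)) · (λ l → M q (l ↑ˡ n))
                       + (λ l → M p (m ↑ʳ l)) · (λ l → M q (m ↑ʳ l)) ≈ I p q
    rowProduct p q = trans (sym (Σ-splitAt m (λ l → M p l * M q l))) (MMᵀ≈I p q)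

    lowerRows : ∀ i j → col B i · col B j + diag d i · diag d j ≈ I (m ↑ʳ i) (m ↑ʳ j)
    lowerRows i j = trans
      (sym (+-cong (·-cong-≗ (block-↑ʳ↑ˡ C B (diag d) i) (block-↑ʳ↑ˡ C B (diag d) j))
                   (·-cong-≗ (block-↑ʳ↑ʳ C B (diag d) i) (block-↑ʳ↑ʳ C B (diag d) j))))
      (rowProduct (m ↑ʳ i) (m ↑ʳ j))

    upperLowerRows : ∀ i j → C i · col B j + B i · diag d j ≈ I (i ↑ˡ n) (m ↑ʳ j)
    upperLowerRows i j = trans
      (sym (+-cong (·-cong-≗ (block-↑ˡ↑ˡ C B (diag d) i) (block-↑ʳ↑ˡ C B (diag d) j))
                   (·-cong-≗ (block-↑ˡ↑ʳ C B (diag d) i) (block-↑ʳ↑ʳ C B (diag d) j))))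
      (rowProduct (i ↑ˡ n) (m ↑ʳ j))

    columns-orthogonal : ∀ i j → i ≢ j → col B i · col B j ≈ 0#
    columns-orthogonal i j i≢j = begin
      col B i · col B j                        ≈⟨ +-identityʳ _ ⟨
      col B i · col B j + 0#                   ≈⟨ +-congˡ diagonal-part≈0 ⟨
      col B i · col B j + diag d i · diag d j  ≈⟨ lowerRows i j ⟩
      I (m ↑ʳ i) (m ↑ʳ j)                      ≈⟨ I-≢ (i≢j ∘ ↑ʳ-injective m i j) ⟩
      0#                                       ∎
      where
      diagonal-part≈0 : diag d i · diag d j ≈ 0#
      diagonal-part≈0 = trans (·-diag (diag d i) d j) (trans (*-congʳ (diag-≢ d i≢j)) (zeroˡ (d j)))

    columns-eigen : ∀ i j → C i · col B j ≈ - d j * B i j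
    columns-eigen i j = begin
      C i · col B j    ≈⟨ +-inverseˡ-unique _ _ Cbⱼ+dⱼbⱼ≈0 ⟩
      - (B i j * d j)  ≈⟨ -‿cong (*-comm (B i j) (d j)) ⟩
      - (d j * B i j)  ≈⟨ -‿distribˡ-* (d j) (B i j) ⟩
      - d j * B i j    ∎
      where
      Cbⱼ+dⱼbⱼ≈0 : C i · col B j + B i j * d j ≈ 0#
      Cbⱼ+dⱼbⱼ≈0 = trans (+-congˡ (sym (·-diag (B i) d j)))
                         (trans (upperLowerRows i j) (I-≢ (↑ˡ≢↑ʳ m n i j)))

lemma1p3 : ∀ {c ℓ₁ ℓ₂ : Level} (F : CompleteOrderedField c ℓ₁ ℓ₂) →
    let open CompleteOrderedField F
        open Matrices F
    in ∀ (m n : ℕ) (C : Mat m m) (B : Mat m n) (d : Fin n → Carrier) →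
       Symmetric C →
       (∀ j → ¬ ZeroVec (col B j)) →
       Orthogonal (block C B (diag d)) →
       (n ≤ℕ m)
       × (∀ i j → i ≢ j → (col B i · col B j) ≈ 0#)
       × (∀ i → Eigenvector C (- d i) (col B i))
lemma1p3 F m n C B d _ b≉0 (MMᵀ≈I , _) =
    independentColumns⇒≤ F B (orthogonal⇒independentColumns F B b≉0 columns-orthogonal)
  , columns-orthogonal
  , λ j → b≉0 j , λ i → columns-eigen i j
  where open OrthonormalRows F C B d MMᵀ≈I
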